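{- Let $\mathcal X=\{0,1\}^n$ with the Hamming distance $d$, and for $x,y\in\mathcal X$ let $\lambda(x,y)=\frac12\sum_{u\in\mathcal X}|d(x,u)-d(y,u)|$. If $d(x,y)=w$ with $1\le w\le n$, then $$\lambda(x,y)=\lambda(w):=2^{n-w}\,w\binom{w-1}{\lceil w/2\rceil-1}.$$ Equivalently, $\lambda(2i-1)=\lambda(2i)=2^{n-2i}\,i\binom{2i}{i}$ for $1\le i\le\lfloor n/2\rfloor$, and $\frac{\lambda(2i+1)}{2i+1}=\frac{\lambda(2i)}{2i}$ for $i\ge1$ (with $2i+1\le n$); consequently $\lambda(i)$ is a monotone (non-decreasing) function of $i$ for $i\ge1$.
   Context: $d(x,y)$ is the Hamming distance, the number of coordinates in which $x,y\in\{0,1\}^n$ differ. -}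

module Defs where

open import Data.Bool using (Bool; true; false)
open import Data.Nat using (ℕ; zero; suc; _+_; _*_; _∸_; _^_; ⌈_/2⌉; ∣_-_∣)
open import Data.Nat.Combinatorics using (_C_)
open import Data.List using (List; []; _∷_; map; _++_)
open import Data.Nat.ListAction using (sum)
open import Data.Vec using (Vec; []; _∷_)

hamming : ∀ {n} → Vec Bool n → Vec Bool n → ℕ
hamming [] [] = 0
hamming (true ∷ xs) (true ∷ ys) = hamming xs ys
hamming (false ∷ xs) (false ∷ ys) = hamming xs ys
hamming (true ∷ xs) (false ∷ ys) = suc (hamming xs ys)
hamming (false ∷ xs) (true ∷ ys) = suc (hamming xs ys)

allVecs : (n : ℕ) → List (Vec Bool n)
allVecs zero = [] ∷ []
allVecs (suc n) = map (false ∷_) (allVecs n) ++ map (true ∷_) (allVecs n)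

twiceLam : ∀ {n} → Vec Bool n → Vec Bool n → ℕ
twiceLam {n} x y = sum (map (λ u → ∣ hamming x u - hamming y u ∣) (allVecs n))

lamW : ℕ → ℕ → ℕ
lamW n w = 2 ^ (n ∸ w) * w * ((w ∸ 1) C (⌈ w /2⌉ ∸ 1))

-- Proof structure.
-- 1. Binomial facts: absorption (k+1)C(n+1,k+1) = (n+1)C(n,k) and two
--    consequences for near-central coefficients C(2m+2,m+1), C(2m+1,m).
-- 2. The profile L(w) = w·C(w-1,⌈w/2⌉-1), so that λ(w) = 2^(n-w) L(w).
--    For c = C(2m+1,m):  L(2m+2) = 2 L(2m+1) = (2m+2) c,  L(2m+3) = (2m+3)·2c.
--    All four parts about λ follow from these by bookkeeping with 2^(n-w).
-- 3. The one-dimensional spread  S_w(a,b) = Σ_{u∈{0,1}^w} |a+|u| - (b+w-|u|)|.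
--    From |a+1-b| + |a-b-1| = 2|a-b| + 2[a=b] we get
--    S_{w+1}(0,0) = 2 S_w(0,0) + 2·T_w, where T_w counts ties |u| = w-|u|:
--    T_w = C(2m,m) if w = 2m and 0 if w is odd.  Induction gives S_w = 2 L(w).
-- 4. Coordinates where x and y agree double the sum, coordinates where they
--    differ shift the offsets, hence Σ_u |d(x,u)-d(y,u)| = 2^(n-w) S_w(0,0).
module Submission where

open import Defs
open import Data.Bool using (Bool; true; false)
open import Data.Nat using (ℕ; zero; suc; _+_; _*_; _∸_; _^_; _≤_; s≤s; ⌈_/2⌉; ∣_-_∣)
open import Data.Nat.Properties
open import Data.Nat.Combinatorics using (_C_; nC1≡n; nCk≡nC[n∸k]; nCk+nC[k+1]≡[n+1]C[k+1])
open import Data.Nat.Tactic.RingSolver using (solve-∀)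
open import Data.Nat.ListAction using (sum)
open import Data.Nat.ListAction.Properties using (sum-++)
open import Data.List using (map; _++_)
open import Data.List.Properties using (map-++; map-∘; map-cong)
open import Data.Vec using (Vec; []; _∷_)
open import Data.Product using (_×_; _,_)
open import Data.Sum using (inj₁; inj₂)
open import Data.Empty using (⊥-elim)
open import Function using (_∘_)
open import Relation.Binary.PropositionalEquality
  using (_≡_; _≢_; refl; sym; trans; cong; cong₂; subst; subst₂; module ≡-Reasoning)

pascal : ∀ n k → n C k + n C suc k ≡ suc n C suc k
pascal = nCk+nC[k+1]≡[n+1]C[k+1]

absorption : ∀ n k → suc k * (suc n C suc k) ≡ suc n * (n C k)
absorption zero    zero    = refl
absorption zero    (suc k) = *-zeroʳ (suc (suc k))
absorption (suc n) zero    =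
  trans (*-identityˡ _) (trans (nC1≡n (suc (suc n))) (sym (*-identityʳ _)))
absorption (suc n) (suc k) = begin
  suc (suc k) * (suc n′ C suc (suc k))           ≡⟨ cong (suc (suc k) *_) (sym (pascal n′ (suc k))) ⟩
  suc (suc k) * (A + B)                          ≡⟨ *-distribˡ-+ (suc (suc k)) A B ⟩
  (A + suc k * A) + suc (suc k) * B               ≡⟨ +-assoc A (suc k * A) _ ⟩
  A + (suc k * A + suc (suc k) * B)               ≡⟨ cong (A +_) (cong₂ _+_ (absorption n k) (absorption n (suc k))) ⟩
  A + (n′ * (n C k) + n′ * (n C suc k))           ≡⟨ cong (A +_) (sym (*-distribˡ-+ n′ (n C k) _)) ⟩
  A + n′ * (n C k + n C suc k)                    ≡⟨ cong (λ t → A + n′ * t) (pascal n k) ⟩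
  suc n′ * A                                      ∎
  where
  open ≡-Reasoning
  n′ = suc n
  A  = n′ C suc k
  B  = n′ C suc (suc k)

central-symmetry : ∀ m → suc (m + m) C suc m ≡ suc (m + m) C m
central-symmetry m =
  trans (nCk≡nC[n∸k] (s≤s (m≤n+m m m))) (cong (suc (m + m) C_) (m+n∸n≡m m m))

central-pascal : ∀ m → suc (suc (m + m)) C suc m ≡ 2 * (suc (m + m) C m)
central-pascal m = begin
  suc (suc (m + m)) C suc m                 ≡⟨ sym (pascal (suc (m + m)) m) ⟩
  c + suc (m + m) C suc m                   ≡⟨ cong (c +_) (central-symmetry m) ⟩
  c + c                                     ≡⟨ cong (c +_) (sym (+-identityʳ c)) ⟩
  2 * c                                     ∎
  where
  open ≡-Reasoning
  c = suc (m + m) C m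

central-absorption : ∀ m → suc m * (suc (m + m) C m) ≡ suc (m + m) * ((m + m) C m)
central-absorption m = trans (cong (suc m *_) (sym (central-symmetry m))) (absorption (m + m) m)

profile : ℕ → ℕ
profile w = w * ((w ∸ 1) C (⌈ w /2⌉ ∸ 1))

lamW-profile : ∀ n w → lamW n w ≡ 2 ^ (n ∸ w) * profile w
lamW-profile n w = *-assoc (2 ^ (n ∸ w)) w _

-- Below the top dimension, λ(w) = 2^(n-w-1)·2L(w): the form used to compare
-- λ(w) with λ(w+1).
lamW-halve : ∀ n w → suc w ≤ n → lamW n w ≡ 2 ^ (n ∸ suc w) * (2 * profile w)
lamW-halve n w w<n = begin
  lamW n w                                   ≡⟨ lamW-profile n w ⟩
  2 ^ (n ∸ w) * profile w                    ≡⟨ cong (λ e → 2 ^ e * profile w) (+-∸-assoc 1 w<n) ⟩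
  2 * P * profile w                          ≡⟨ cong (_* profile w) (*-comm 2 P) ⟩
  P * 2 * profile w                          ≡⟨ *-assoc P 2 (profile w) ⟩
  P * (2 * profile w)                        ∎
  where
  open ≡-Reasoning
  P = 2 ^ (n ∸ suc w)

profile-odd : ∀ m → profile (suc (m + m)) ≡ suc (m + m) * ((m + m) C m)
profile-odd m = cong (λ k → suc (m + m) * ((m + m) C k)) (sym (n≡⌊n+n/2⌋ m))

profile-even : ∀ m → profile (suc (suc (m + m))) ≡ suc (suc (m + m)) * (suc (m + m) C m)
profile-even m = cong (λ k → suc (suc (m + m)) * (suc (m + m) C k)) (sym (n≡⌈n+n/2⌉ m))

twice-suc : ∀ m c → suc (suc (m + m)) * c ≡ 2 * (suc m * c)
twice-suc = solve-∀

move-two : ∀ a c → a * (2 * c) ≡ 2 * (a * c)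
move-two = solve-∀

profile-even-double : ∀ m → profile (suc (suc (m + m))) ≡ 2 * profile (suc (m + m))
profile-even-double m = begin
  profile (suc (suc (m + m)))                      ≡⟨ profile-even m ⟩
  suc (suc (m + m)) * (suc (m + m) C m)            ≡⟨ twice-suc m (suc (m + m) C m) ⟩
  2 * (suc m * (suc (m + m) C m))                  ≡⟨ cong (2 *_) (central-absorption m) ⟩
  2 * (suc (m + m) * ((m + m) C m))                ≡⟨ cong (2 *_) (sym (profile-odd m)) ⟩
  2 * profile (suc (m + m))                        ∎
  where open ≡-Reasoning

profile-even-central : ∀ m → profile (suc (suc (m + m))) ≡ suc m * (suc (suc (m + m)) C suc m)
profile-even-central m = begin
  profile (suc (suc (m + m)))                      ≡⟨ profile-even m ⟩
  suc (suc (m + m)) * c                            ≡⟨ twice-suc m c ⟩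
  2 * (suc m * c)                                  ≡⟨ sym (move-two (suc m) c) ⟩
  suc m * (2 * c)                                  ≡⟨ cong (suc m *_) (sym (central-pascal m)) ⟩
  suc m * (suc (suc (m + m)) C suc m)              ∎
  where
  open ≡-Reasoning
  c = suc (m + m) C m

profile-odd-next : ∀ m → profile (suc (suc (suc (m + m)))) ≡ suc (suc (suc (m + m))) * (2 * (suc (m + m) C m))
profile-odd-next m = begin
  profile (suc w)                                  ≡⟨ cong (profile ∘ suc) (sym w≡) ⟩
  profile (suc (suc m + suc m))                    ≡⟨ profile-odd (suc m) ⟩
  suc (suc m + suc m) * ((suc m + suc m) C suc m)  ≡⟨ cong (λ v → suc v * (v C suc m)) w≡ ⟩
  suc w * (w C suc m)                              ≡⟨ cong (suc w *_) (central-pascal m) ⟩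
  suc w * (2 * (suc (m + m) C m))                  ∎
  where
  open ≡-Reasoning
  w = suc (suc (m + m))
  w≡ : suc m + suc m ≡ w
  w≡ = cong suc (+-suc m m)

-- The ratio identity L(2i+1)/(2i+1) = 2·L(2i)/(2i), cleared of denominators.
profile-ratio : ∀ m → profile (suc (suc (suc (m + m)))) * suc (suc (m + m))
                    ≡ 2 * profile (suc (suc (m + m))) * suc (suc (suc (m + m)))
profile-ratio m
  rewrite profile-odd-next m | profile-even m = rearrange (suc (suc (m + m))) (suc (m + m) C m)
  where
  rearrange : ∀ a c → suc a * (2 * c) * a ≡ 2 * (a * c) * suc a
  rearrange = solve-∀

data Parity : ℕ → Set where
  odd  : ∀ m → Parity (suc (m + m))
  even : ∀ m → Parity (suc (suc (m + m)))

parity : ∀ w → Parity (suc w)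
parity zero = odd 0
parity (suc w) with parity w
... | odd m  = even m
... | even m = subst Parity (cong (suc ∘ suc) (+-suc m m)) (odd (suc m))

-- 2L(w) ≤ L(w+1): equality for odd w, factor (2m+3)/(2m+2) for w = 2m+2.
profile-growth : ∀ w → 1 ≤ w → 2 * profile w ≤ profile (suc w)
profile-growth (suc w) _ with parity w
... | odd m  = ≤-reflexive (sym (profile-even-double m))
... | even m = begin
  2 * profile (suc (suc (m + m)))                  ≡⟨ cong (2 *_) (profile-even m) ⟩
  2 * (suc (suc (m + m)) * c)                      ≡⟨ sym (move-two (suc (suc (m + m))) c) ⟩
  suc (suc (m + m)) * (2 * c)                      ≤⟨ *-monoˡ-≤ (2 * c) (n≤1+n (suc (suc (m + m)))) ⟩
  suc (suc (suc (m + m))) * (2 * c)                ≡⟨ sym (profile-odd-next m) ⟩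
  profile (suc (suc (suc (m + m))))                ∎
  where
  open ≤-Reasoning
  c = suc (m + m) C m

tie : ℕ → ℕ → ℕ
tie zero    zero    = 1
tie zero    (suc b) = 0
tie (suc a) zero    = 0
tie (suc a) (suc b) = tie a b

tie-refl : ∀ a → tie a a ≡ 1
tie-refl zero    = refl
tie-refl (suc a) = tie-refl a

tie-≢ : ∀ a b → a ≢ b → tie a b ≡ 0
tie-≢ zero    zero    a≢b = ⊥-elim (a≢b refl)
tie-≢ zero    (suc b) _   = refl
tie-≢ (suc a) zero    _   = refl
tie-≢ (suc a) (suc b) a≢b = tie-≢ a b (a≢b ∘ cong suc)

-- spread w a b = Σ_{u ∈ {0,1}^w} |a + |u| - (b + w - |u|)|, organised by the
-- first coordinate of u.
spread : ℕ → ℕ → ℕ → ℕ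
spread zero    a b = ∣ a - b ∣
spread (suc w) a b = spread w (suc a) b + spread w a (suc b)

-- ties w a b = #{u ∈ {0,1}^w : a + |u| = b + w - |u|}.
ties : ℕ → ℕ → ℕ → ℕ
ties zero    a b = tie a b
ties (suc w) a b = ties w (suc a) b + ties w a (suc b)

shift-pair : ∀ a b → ∣ suc a - b ∣ + ∣ a - suc b ∣ ≡ 2 * ∣ a - b ∣ + 2 * tie a b
shift-pair zero    zero    = refl
shift-pair zero    (suc b) = regroup b
  where
  regroup : ∀ b → b + suc (suc b) ≡ 2 * suc b + 0
  regroup = solve-∀
shift-pair (suc a) zero    = trans (cong (suc (suc a) +_) (∣-∣-identityʳ a)) (regroup a)
  where
  regroup : ∀ a → suc (suc a) + a ≡ 2 * suc a + 0
  regroup = solve-∀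
shift-pair (suc a) (suc b) = shift-pair a b

spread-step : ∀ w a b → spread w (suc a) b + spread w a (suc b) ≡ 2 * spread w a b + 2 * ties w a b
spread-step zero    a b = shift-pair a b
spread-step (suc w) a b = trans
  (cong₂ _+_ (spread-step w (suc a) b) (spread-step w a (suc b)))
  (regroup (spread w (suc a) b) (spread w a (suc b)) (ties w (suc a) b) (ties w a (suc b)))
  where
  regroup : ∀ x y z t → (2 * x + 2 * z) + (2 * y + 2 * t) ≡ 2 * (x + y) + 2 * (z + t)
  regroup = solve-∀

add-double-suc : ∀ a k → a + (suc k + suc k) ≡ suc (suc (a + (k + k)))
add-double-suc = solve-∀

-- A tie needs a + 2k = b + w for some k (k = number of ones); otherwise none occur.
ties-none : ∀ w a b → (∀ k → a + (k + k) ≢ b + w) → ties w a b ≡ 0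
ties-none zero a b none =
  tie-≢ a b (λ a≡b → none 0 (trans (+-identityʳ a) (trans a≡b (sym (+-identityʳ b)))))
ties-none (suc w) a b none = cong₂ _+_
  (ties-none w (suc a) b (λ k e → none (suc k)
    (trans (add-double-suc a k) (trans (cong suc e) (sym (+-suc b w))))))
  (ties-none w a (suc b) (λ k e → none k (trans e (sym (+-suc b w)))))

-- If a + 2k = b + w, the ties are the vectors with exactly k ones.
ties-central : ∀ w a b k → a + (k + k) ≡ b + w → ties w a b ≡ w C k
ties-central zero a b zero e =
  subst (λ b′ → tie a b′ ≡ 1) (+-cancelʳ-≡ 0 a b e) (tie-refl a)
ties-central zero a b (suc k) e =
  tie-≢ a b (λ a≡b → m+1+n≢m a (trans e (trans (+-identityʳ b) (sym a≡b))))
ties-central (suc w) a b zero e = cong₂ _+_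
  (ties-none w (suc a) b too-far)
  (ties-central w a (suc b) zero (trans e (+-suc b w)))
  where
  a≡ : a ≡ suc (b + w)
  a≡ = trans (sym (+-identityʳ a)) (trans e (+-suc b w))
  too-far : ∀ k → suc a + (k + k) ≢ b + w
  too-far k e′ = 1+n≰n (begin
    suc (b + w)              ≤⟨ n≤1+n _ ⟩
    suc (suc (b + w))        ≡⟨ cong suc (sym a≡) ⟩
    suc a                    ≤⟨ m≤m+n (suc a) (k + k) ⟩
    suc a + (k + k)          ≡⟨ e′ ⟩
    b + w                    ∎)
    where open ≤-Reasoning
ties-central (suc w) a b (suc k) e = trans
  (cong₂ _+_
    (ties-central w (suc a) b k
      (suc-injective (trans (sym (add-double-suc a k)) (trans e (+-suc b w)))))
    (ties-central w a (suc b) (suc k) (trans e (+-suc b w))))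
  (pascal w k)

double≢odd : ∀ k m → k + k ≢ suc (m + m)
double≢odd k m e =
  even≢odd k m (trans (cong (k +_) (+-identityʳ k)) (trans e (cong suc (cong (m +_) (sym (+-identityʳ m))))))

spread-odd  : ∀ m → spread (suc (m + m)) 0 0 ≡ 2 * profile (suc (m + m))
spread-even : ∀ m → spread (suc (suc (m + m))) 0 0 ≡ 2 * profile (suc (suc (m + m)))

spread-odd zero = refl
spread-odd (suc m) rewrite +-suc m m = begin
  spread (suc w) 0 0                                  ≡⟨ spread-step w 0 0 ⟩
  2 * spread w 0 0 + 2 * ties w 0 0                   ≡⟨ cong₂ (λ s t → 2 * s + 2 * t) (spread-even m) ties-w ⟩
  2 * (2 * profile w) + 2 * (w C suc m)               ≡⟨ cong₂ (λ l t → 2 * (2 * l) + 2 * t) (profile-even m) (central-pascal m) ⟩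
  2 * (2 * (w * c)) + 2 * (2 * c)                     ≡⟨ regroup (m + m) c ⟩
  2 * (suc w * (2 * c))                               ≡⟨ cong (2 *_) (sym (profile-odd-next m)) ⟩
  2 * profile (suc w)                                 ∎
  where
  open ≡-Reasoning
  w = suc (suc (m + m))
  c = suc (m + m) C m
  ties-w : ties w 0 0 ≡ w C suc m
  ties-w = ties-central w 0 0 (suc m) (cong suc (+-suc m m))
  regroup : ∀ v d → 2 * (2 * (suc (suc v) * d)) + 2 * (2 * d) ≡ 2 * (suc (suc (suc v)) * (2 * d))
  regroup = solve-∀

spread-even m = begin
  spread (suc w) 0 0                                  ≡⟨ spread-step w 0 0 ⟩
  2 * spread w 0 0 + 2 * ties w 0 0                   ≡⟨ cong₂ (λ s t → 2 * s + 2 * t) (spread-odd m) no-ties ⟩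
  2 * (2 * profile w) + 0                             ≡⟨ +-identityʳ _ ⟩
  2 * (2 * profile w)                                 ≡⟨ cong (2 *_) (sym (profile-even-double m)) ⟩
  2 * profile (suc w)                                 ∎
  where
  open ≡-Reasoning
  w = suc (m + m)
  no-ties : ties w 0 0 ≡ 0
  no-ties = ties-none w 0 0 (λ k → double≢odd k m)

spread-profile : ∀ w → 1 ≤ w → spread w 0 0 ≡ 2 * profile w
spread-profile (suc w) _ with parity w
... | odd m  = spread-odd m
... | even m = spread-even m

agreements : ∀ {n} → Vec Bool n → Vec Bool n → ℕ
agreements []           []           = 0
agreements (true  ∷ xs) (true  ∷ ys) = suc (agreements xs ys)
agreements (false ∷ xs) (false ∷ ys) = suc (agreements xs ys)
agreements (true  ∷ xs) (false ∷ ys) = agreements xs ys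
agreements (false ∷ xs) (true  ∷ ys) = agreements xs ys

agreements+hamming : ∀ {n} (x y : Vec Bool n) → agreements x y + hamming x y ≡ n
agreements+hamming []           []           = refl
agreements+hamming (true  ∷ xs) (true  ∷ ys) = cong suc (agreements+hamming xs ys)
agreements+hamming (false ∷ xs) (false ∷ ys) = cong suc (agreements+hamming xs ys)
agreements+hamming (true  ∷ xs) (false ∷ ys) = trans (+-suc _ _) (cong suc (agreements+hamming xs ys))
agreements+hamming (false ∷ xs) (true  ∷ ys) = trans (+-suc _ _) (cong suc (agreements+hamming xs ys))

agreements≡ : ∀ {n} (x y : Vec Bool n) → agreements x y ≡ n ∸ hamming x y
agreements≡ {n} x y = begin
  agreements x y                                 ≡⟨ sym (m+n∸n≡m (agreements x y) (hamming x y)) ⟩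
  agreements x y + hamming x y ∸ hamming x y     ≡⟨ cong (_∸ hamming x y) (agreements+hamming x y) ⟩
  n ∸ hamming x y                                ∎
  where open ≡-Reasoning

sum-allVecs : ∀ {n} (F : Vec Bool (suc n) → ℕ) →
  sum (map F (allVecs (suc n))) ≡ sum (map (F ∘ (false ∷_)) (allVecs n)) + sum (map (F ∘ (true ∷_)) (allVecs n))
sum-allVecs {n} F = begin
  sum (map F (map (false ∷_) us ++ map (true ∷_) us))              ≡⟨ cong sum (map-++ F (map (false ∷_) us) _) ⟩
  sum (map F (map (false ∷_) us) ++ map F (map (true ∷_) us))      ≡⟨ sum-++ (map F (map (false ∷_) us)) _ ⟩
  sum (map F (map (false ∷_) us)) + sum (map F (map (true ∷_) us)) ≡⟨ cong₂ _+_ (cong sum (sym (map-∘ us))) (cong sum (sym (map-∘ us))) ⟩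
  sum (map (F ∘ (false ∷_)) us) + sum (map (F ∘ (true ∷_)) us)     ∎
  where
  open ≡-Reasoning
  us = allVecs n

gap : ∀ {n} → Vec Bool n → Vec Bool n → ℕ → ℕ → Vec Bool n → ℕ
gap x y a b u = ∣ hamming x u + a - (hamming y u + b) ∣

offsetSum : ∀ {n} → Vec Bool n → Vec Bool n → ℕ → ℕ → ℕ
offsetSum {n} x y a b = sum (map (gap x y a b) (allVecs n))

twiceLam≡offsetSum : ∀ {n} (x y : Vec Bool n) → twiceLam x y ≡ offsetSum x y 0 0
twiceLam≡offsetSum {n} x y = cong sum (map-cong add-zeros (allVecs n))
  where
  add-zeros : ∀ u → ∣ hamming x u - hamming y u ∣ ≡ gap x y 0 0 u
  add-zeros u = sym (cong₂ ∣_-_∣ (+-identityʳ (hamming x u)) (+-identityʳ (hamming y u)))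

gap-shiftˡ : ∀ {n} (x y : Vec Bool n) a b v → ∣ suc (hamming x v) + a - (hamming y v + b) ∣ ≡ gap x y (suc a) b v
gap-shiftˡ x y a b v = cong (∣_- hamming y v + b ∣) (sym (+-suc (hamming x v) a))

gap-shiftʳ : ∀ {n} (x y : Vec Bool n) a b v → ∣ hamming x v + a - (suc (hamming y v) + b) ∣ ≡ gap x y a (suc b) v
gap-shiftʳ x y a b v = cong (∣ hamming x v + a -_∣) (sym (+-suc (hamming y v) b))

double-sum : ∀ p s → p * s + p * s ≡ 2 * p * s
double-sum = solve-∀

-- The reduction to one dimension: an agreeing coordinate doubles the sum, a
-- differing one splits it into the two shifted offsets.
offsetSum-spread : ∀ {n} (x y : Vec Bool n) a b →
  offsetSum x y a b ≡ 2 ^ agreements x y * spread (hamming x y) a b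
offsetSum-spread [] [] a b = refl
offsetSum-spread (true ∷ xs) (true ∷ ys) a b = trans (sum-allVecs (gap (true ∷ xs) (true ∷ ys) a b))
  (trans (cong₂ _+_ (offsetSum-spread xs ys a b) (offsetSum-spread xs ys a b)) (double-sum (2 ^ agreements xs ys) (spread (hamming xs ys) a b)))
offsetSum-spread (false ∷ xs) (false ∷ ys) a b = trans (sum-allVecs (gap (false ∷ xs) (false ∷ ys) a b))
  (trans (cong₂ _+_ (offsetSum-spread xs ys a b) (offsetSum-spread xs ys a b)) (double-sum (2 ^ agreements xs ys) (spread (hamming xs ys) a b)))
offsetSum-spread {suc n} (true ∷ xs) (false ∷ ys) a b = begin
  offsetSum (true ∷ xs) (false ∷ ys) a b                          ≡⟨ sum-allVecs F ⟩
  half false + half true                                          ≡⟨ cong₂ _+_ (cong sum (map-cong (gap-shiftˡ xs ys a b) us))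
                                                                               (cong sum (map-cong (gap-shiftʳ xs ys a b) us)) ⟩
  offsetSum xs ys (suc a) b + offsetSum xs ys a (suc b)            ≡⟨ cong₂ _+_ (offsetSum-spread xs ys (suc a) b) (offsetSum-spread xs ys a (suc b)) ⟩
  P * spread w (suc a) b + P * spread w a (suc b)                  ≡⟨ sym (*-distribˡ-+ P _ _) ⟩
  P * spread (suc w) a b                                          ∎
  where
  open ≡-Reasoning
  F = gap (true ∷ xs) (false ∷ ys) a b
  us = allVecs n
  half : Bool → ℕ
  half c = sum (map (F ∘ (c ∷_)) us)
  P = 2 ^ agreements xs ys
  w = hamming xs ys
offsetSum-spread {suc n} (false ∷ xs) (true ∷ ys) a b = begin
  offsetSum (false ∷ xs) (true ∷ ys) a b                          ≡⟨ sum-allVecs F ⟩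
  half false + half true                                          ≡⟨ cong₂ _+_ (cong sum (map-cong (gap-shiftʳ xs ys a b) us))
                                                                               (cong sum (map-cong (gap-shiftˡ xs ys a b) us)) ⟩
  offsetSum xs ys a (suc b) + offsetSum xs ys (suc a) b            ≡⟨ +-comm (offsetSum xs ys a (suc b)) _ ⟩
  offsetSum xs ys (suc a) b + offsetSum xs ys a (suc b)            ≡⟨ cong₂ _+_ (offsetSum-spread xs ys (suc a) b) (offsetSum-spread xs ys a (suc b)) ⟩
  P * spread w (suc a) b + P * spread w a (suc b)                  ≡⟨ sym (*-distribˡ-+ P _ _) ⟩
  P * spread (suc w) a b                                          ∎
  where
  open ≡-Reasoning
  F = gap (false ∷ xs) (true ∷ ys) a b
  us = allVecs n
  half : Bool → ℕ
  half c = sum (map (F ∘ (c ∷_)) us)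
  P = 2 ^ agreements xs ys
  w = hamming xs ys

twiceLam-formula : ∀ {n} (x y : Vec Bool n) w → hamming x y ≡ w → 1 ≤ w → twiceLam x y ≡ 2 * lamW n w
twiceLam-formula {n} x y w refl 1≤w = begin
  twiceLam x y                                   ≡⟨ twiceLam≡offsetSum x y ⟩
  offsetSum x y 0 0                              ≡⟨ offsetSum-spread x y 0 0 ⟩
  2 ^ agreements x y * spread w 0 0              ≡⟨ cong₂ (λ e s → 2 ^ e * s) (agreements≡ x y) (spread-profile w 1≤w) ⟩
  2 ^ (n ∸ w) * (2 * profile w)                  ≡⟨ move-two (2 ^ (n ∸ w)) (profile w) ⟩
  2 * (2 ^ (n ∸ w) * profile w)                  ≡⟨ cong (2 *_) (sym (lamW-profile n w)) ⟩
  2 * lamW n w                                   ∎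
  where open ≡-Reasoning

double-suc : ∀ m → 2 * suc m ≡ suc (suc (m + m))
double-suc = solve-∀

double-suc+1 : ∀ m → 2 * suc m + 1 ≡ suc (suc (suc (m + m)))
double-suc+1 = solve-∀

central-values-suc : ∀ n m → suc (suc (m + m)) ≤ n →
  (lamW n (suc (m + m)) ≡ 2 ^ (n ∸ suc (suc (m + m))) * suc m * (suc (suc (m + m)) C suc m))
  × (lamW n (suc (suc (m + m))) ≡ 2 ^ (n ∸ suc (suc (m + m))) * suc m * (suc (suc (m + m)) C suc m))
central-values-suc n m w≤n = odd-value , even-value
  where
  open ≡-Reasoning
  w = suc (suc (m + m))
  P = 2 ^ (n ∸ w)
  even-value : lamW n w ≡ P * suc m * (w C suc m)
  even-value = begin
    lamW n w                               ≡⟨ lamW-profile n w ⟩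
    P * profile w                          ≡⟨ cong (P *_) (profile-even-central m) ⟩
    P * (suc m * (w C suc m))              ≡⟨ sym (*-assoc P (suc m) _) ⟩
    P * suc m * (w C suc m)                ∎
  odd-value : lamW n (suc (m + m)) ≡ P * suc m * (w C suc m)
  odd-value = begin
    lamW n (suc (m + m))                   ≡⟨ lamW-halve n (suc (m + m)) w≤n ⟩
    P * (2 * profile (suc (m + m)))        ≡⟨ cong (P *_) (sym (profile-even-double m)) ⟩
    P * profile w                          ≡⟨ sym (lamW-profile n w) ⟩
    lamW n w                               ≡⟨ even-value ⟩
    P * suc m * (w C suc m)                ∎

central-values : ∀ n i → 1 ≤ i → 2 * i ≤ n →
  (lamW n (2 * i ∸ 1) ≡ 2 ^ (n ∸ 2 * i) * i * ((2 * i) C i))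
  × (lamW n (2 * i) ≡ 2 ^ (n ∸ 2 * i) * i * ((2 * i) C i))
central-values n (suc m) _ 2i≤n =
  subst (λ w → (lamW n (w ∸ 1) ≡ 2 ^ (n ∸ w) * suc m * (w C suc m))
             × (lamW n w ≡ 2 ^ (n ∸ w) * suc m * (w C suc m)))
        (sym (double-suc m))
        (central-values-suc n m (subst (_≤ n) (double-suc m) 2i≤n))

odd-even-ratio-suc : ∀ n m → suc (suc (suc (m + m))) ≤ n →
  lamW n (suc (suc (suc (m + m)))) * suc (suc (m + m)) ≡ lamW n (suc (suc (m + m))) * suc (suc (suc (m + m)))
odd-even-ratio-suc n m w<n = begin
  lamW n (suc w) * w                       ≡⟨ cong (_* w) (lamW-profile n (suc w)) ⟩
  Q * profile (suc w) * w                  ≡⟨ *-assoc Q _ w ⟩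
  Q * (profile (suc w) * w)                ≡⟨ cong (Q *_) (profile-ratio m) ⟩
  Q * (2 * profile w * suc w)              ≡⟨ sym (*-assoc Q _ (suc w)) ⟩
  Q * (2 * profile w) * suc w              ≡⟨ cong (_* suc w) (sym (lamW-halve n w w<n)) ⟩
  lamW n w * suc w                         ∎
  where
  open ≡-Reasoning
  w = suc (suc (m + m))
  Q = 2 ^ (n ∸ suc w)

odd-even-ratio : ∀ n i → 1 ≤ i → 2 * i + 1 ≤ n →
  lamW n (2 * i + 1) * (2 * i) ≡ lamW n (2 * i) * (2 * i + 1)
odd-even-ratio n (suc m) _ 2i+1≤n =
  subst₂ (λ u w → lamW n u * w ≡ lamW n w * u) (sym (double-suc+1 m)) (sym (double-suc m))
         (odd-even-ratio-suc n m (subst (_≤ n) (double-suc+1 m) 2i+1≤n))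

lamW-step : ∀ n w → 1 ≤ w → suc w ≤ n → lamW n w ≤ lamW n (suc w)
lamW-step n w 1≤w w<n = begin
  lamW n w                                 ≡⟨ lamW-halve n w w<n ⟩
  P * (2 * profile w)                      ≤⟨ *-monoʳ-≤ P (profile-growth w 1≤w) ⟩
  P * profile (suc w)                      ≡⟨ sym (lamW-profile n (suc w)) ⟩
  lamW n (suc w)                           ∎
  where
  open ≤-Reasoning
  P = 2 ^ (n ∸ suc w)

lamW-mono : ∀ n i j → 1 ≤ i → i ≤ j → j ≤ n → lamW n i ≤ lamW n j
lamW-mono n (suc i) zero _ () _
lamW-mono n i (suc j) 1≤i i≤j+1 j+1≤n with m≤n⇒m<n∨m≡n i≤j+1
... | inj₂ refl      = ≤-refl
... | inj₁ (s≤s i≤j) =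
  ≤-trans (lamW-mono n i j 1≤i i≤j (<⇒≤ j+1≤n)) (lamW-step n j (≤-trans 1≤i i≤j) j+1≤n)

lemma3p1 : (n : ℕ) →
    ((x y : Vec Bool n) (w : ℕ) → hamming x y ≡ w → 1 ≤ w → w ≤ n →
      twiceLam x y ≡ 2 * lamW n w)
    × ((i : ℕ) → 1 ≤ i → 2 * i ≤ n →
      (lamW n (2 * i ∸ 1) ≡ 2 ^ (n ∸ 2 * i) * i * ((2 * i) C i))
      × (lamW n (2 * i) ≡ 2 ^ (n ∸ 2 * i) * i * ((2 * i) C i)))
    × ((i : ℕ) → 1 ≤ i → 2 * i + 1 ≤ n →
      lamW n (2 * i + 1) * (2 * i) ≡ lamW n (2 * i) * (2 * i + 1))
    × ((i j : ℕ) → 1 ≤ i → i ≤ j → j ≤ n → lamW n i ≤ lamW n j)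
lemma3p1 n =
    (λ x y w d≡w 1≤w _ → twiceLam-formula x y w d≡w 1≤w)
  , central-values n
  , odd-even-ratio n
  , lamW-mono n
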